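{- Every Q-SoS refutation of $\mathsf{Parity}_n$ has Q-size $\exp(\Omega(n))$.
   Context: $\mathsf{Parity}_n$ is the QBF $\exists x_1\cdots\exists x_n\forall u\exists t_1\cdots\exists t_n.\ (t_1\leftrightarrow x_1)\wedge(u\nleftrightarrow t_n)\wedge\bigwedge_{i=2}^n(t_i\leftrightarrow t_{i-1}\oplus x_i)$, with each constraint written as the standard CNF (set of clauses) on its variables. For each variable $v$ let $\overline v$ be a twin variable; a clause $C=\bigvee_{v\in P}v\vee\bigvee_{v\in N}\neg v$ is encoded as $\mathrm{enc}(C)=\{\prod_{v\in P}\overline v\prod_{v\in N}v\}\cup\{v^2-v,\ v+\overline v-1: v\in P\cup N\}$, and $\mathrm{enc}(\phi)=\bigcup_{C\in\phi}\mathrm{enc}(C)$. A Q-SoS refutation of a QBF $\mathcal Q.\phi$ is a polynomial identity over $\mathbb Q$ of the form $\sum_{p\in \mathrm{enc}(\phi)}q_pp+\sum_{u}q_u(1-2u)+q+1=0$, where $u$ ranges over universal variables, every variable $v$ or $\overline v$ occurring in $q_u$ has $v$ quantified to the left of $u$, and $q$ is a sum of squares. Its Q-size is the total number of monomials (with repetition) in the polynomials $q_u$. -}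

module Defs where

open import Data.Nat using (ℕ; zero; suc; _+_; _*_; _≡ᵇ_)
open import Data.Fin using (Fin; toℕ; inject₁; fromℕ) renaming (zero to fzero; suc to fsuc)
open import Data.List using (List; []; _∷_; [_]; _++_; map; concatMap; foldr; length; filterᵇ; deduplicateᵇ)
open import Data.List.Relation.Unary.All using (All)
open import Data.List.Membership.Propositional using (_∈_)
open import Data.Bool using (Bool; true; false; not; _xor_; _∧_)
open import Data.Product using (_×_; _,_; proj₁; proj₂)
open import Data.Rational using (ℚ; 0ℚ; 1ℚ) renaming (_+_ to _+ℚ_; _*_ to _*ℚ_; -_ to -ℚ_; _≟_ to _≟ℚ_)
open import Data.Unit using (⊤)
open import Data.Empty using (⊥)
open import Relation.Binary.PropositionalEquality using (_≡_; _≢_)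
open import Relation.Nullary.Decidable using (does)

-- Variables of Parity_n (indices Fin n: fzero is index 1, fromℕ is index n)

data Var (n : ℕ) : Set where
  x : Fin n → Var n
  u : Var n
  t : Fin n → Var n

data PVar (n : ℕ) : Set where
  plain : Var n → PVar n
  twin  : Var n → PVar n

codeVar : {n : ℕ} → Var n → ℕ
codeVar     (x i) = toℕ i
codeVar {n} u     = n
codeVar {n} (t i) = suc (n + toℕ i)

code : {n : ℕ} → PVar n → ℕ
code     (plain v) = codeVar v
code {n} (twin v)  = suc (n + n) + codeVar v

-- (boolean) equality of polynomial variables (code is injective)
_==_ : {n : ℕ} → PVar n → PVar n → Bool
a == b = code a ≡ᵇ code b

-- Polynomials over ℚ in the variables PVar n, as formal lists of terms.
-- A monomial is a multiset of variables (list up to permutation).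

Monomial : ℕ → Set
Monomial n = List (PVar n)

Poly : ℕ → Set
Poly n = List (ℚ × Monomial n)

count : {n : ℕ} → PVar n → Monomial n → ℕ
count v m = length (filterᵇ (λ w → v == w) m)

allᵇ : {A : Set} → (A → Bool) → List A → Bool
allᵇ p [] = true
allᵇ p (a ∷ as) = p a ∧ allᵇ p as

monoEq : {n : ℕ} → Monomial n → Monomial n → Bool
monoEq m m' = allᵇ (λ v → count v m ≡ᵇ count v m') (m ++ m')

coeff : {n : ℕ} → Poly n → Monomial n → ℚ
coeff p m = foldr _+ℚ_ 0ℚ (map proj₁ (filterᵇ (λ tm → monoEq (proj₂ tm) m) p))

IsZeroPoly : {n : ℕ} → Poly n → Set
IsZeroPoly p = ∀ m → coeff p m ≡ 0ℚ

const : {n : ℕ} → ℚ → Poly n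
const c = [ (c , []) ]

var : {n : ℕ} → PVar n → Poly n
var v = [ (1ℚ , [ v ]) ]

infixl 6 _+P_ _-P_
infixl 7 _*P_

_+P_ : {n : ℕ} → Poly n → Poly n → Poly n
p +P q = p ++ q

negP : {n : ℕ} → Poly n → Poly n
negP p = map (λ tm → (-ℚ proj₁ tm , proj₂ tm)) p

_-P_ : {n : ℕ} → Poly n → Poly n → Poly n
p -P q = p +P negP q

_*P_ : {n : ℕ} → Poly n → Poly n → Poly n
p *P q = concatMap (λ a → map (λ b → (proj₁ a *ℚ proj₁ b , proj₂ a ++ proj₂ b)) q) p

sumP : {n : ℕ} → List (Poly n) → Poly n
sumP = foldr _+P_ []

sos : {n : ℕ} → List (Poly n) → Poly n
sos ss = sumP (map (λ s → s *P s) ss)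

numMonomials : {n : ℕ} → Poly n → ℕ
numMonomials p =
  length (filterᵇ (λ m → not (does (coeff p m ≟ℚ 0ℚ)))
                  (deduplicateᵇ monoEq (map proj₂ p)))

-- literal (true , v) is v, literal (false , v) is ¬ v
Clause : ℕ → Set
Clause n = List (Bool × Var n)

CNF : ℕ → Set
CNF n = List (Clause n)

litFactor : {n : ℕ} → Bool × Var n → PVar n
litFactor (true  , v) = twin v
litFactor (false , v) = plain v

boolAx : {n : ℕ} → Var n → List (Poly n)
boolAx v =
  (var (plain v) *P var (plain v) -P var (plain v)) ∷
  (var (plain v) +P var (twin v) -P const 1ℚ) ∷ []

enc : {n : ℕ} → Clause n → List (Poly n)
enc C = [ (1ℚ , map litFactor C) ] ∷ concatMap (λ l → boolAx (proj₂ l)) C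

encCNF : {n : ℕ} → CNF n → List (Poly n)
encCNF φ = concatMap enc φ

iffCNF : {n : ℕ} → Var n → Var n → CNF n
iffCNF a b = ((false , a) ∷ (true , b) ∷ []) ∷ ((true , a) ∷ (false , b) ∷ []) ∷ []

xorCNF : {n : ℕ} → Var n → Var n → CNF n
xorCNF a b = ((true , a) ∷ (true , b) ∷ []) ∷ ((false , a) ∷ (false , b) ∷ []) ∷ []

-- clauses of  c ↔ a ⊕ b : for each assignment a=α, b=β exclude c = ¬(α ⊕ β)
xor3Clause : {n : ℕ} → Var n → Var n → Var n → Bool → Bool → Clause n
xor3Clause a b c α β = (not α , a) ∷ (not β , b) ∷ (α xor β , c) ∷ []

xor3CNF : {n : ℕ} → Var n → Var n → Var n → CNF n
xor3CNF a b c =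
  xor3Clause a b c false false ∷ xor3Clause a b c false true ∷
  xor3Clause a b c true false ∷ xor3Clause a b c true true ∷ []

allFinL : (m : ℕ) → List (Fin m)
allFinL zero = []
allFinL (suc m) = fzero ∷ map fsuc (allFinL m)

parityCNF : (m : ℕ) → CNF (suc m)
parityCNF m =
  iffCNF (t fzero) (x fzero) ++
  xorCNF u (t (fromℕ m)) ++
  concatMap (λ j → xor3CNF (t (inject₁ j)) (x (fsuc j)) (t (fsuc j))) (allFinL m)

-- variables quantified to the left of u (quantifier prefix ∃x ∀u ∃t): x_i and their twins
LeftOfU : {n : ℕ} → PVar n → Set
LeftOfU (plain (x i)) = ⊤
LeftOfU (twin (x i))  = ⊤
LeftOfU _             = ⊥

record QSoSRefutation (m : ℕ) : Set where
  field
    axiomPart     : List (Poly (suc m) × Poly (suc m))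
    axiomsFromEnc : All (λ qp → proj₂ qp ∈ encCNF (parityCNF m)) axiomPart
    qᵤ            : Poly (suc m)
    qᵤ-scope      : ∀ mono → coeff qᵤ mono ≢ 0ℚ → All LeftOfU mono
    squares       : List (Poly (suc m))
    identity      : IsZeroPoly
                      (sumP (map (λ qp → proj₁ qp *P proj₂ qp) axiomPart)
                       +P qᵤ *P (const 1ℚ -P (var (plain u) +P var (plain u)))
                       +P sos squares
                       +P const 1ℚ)

-- Q-size: total number of monomials in the q_u (one universal variable u)
qSize : {m : ℕ} → QSoSRefutation m → ℕ
qSize r = numMonomials (QSoSRefutation.qᵤ r)

{-# OPTIONS --safe #-}
-- Fix x ∈ {0,1}ⁿ, and set tᵢ = x₁ ⊕ ⋯ ⊕ xᵢ and u = ¬ tₙ. This assignment satisfies the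
-- matrix of Parityₙ, so every axiom vanishes there and the refutation identity becomes
-- qᵤ(x)·(1 − 2u) = −(1 + q) < 0. Since qᵤ only mentions the xᵢ and x̄ᵢ, it is a polynomial in
-- literals whose sign at every Boolean point is (−1)^parity(x). Such a polynomial in k variables
-- has at least (3/2)^k monomials. Fixing x₁ = 1, fixing x₁ = 0, and taking the difference of
-- these two restrictions gives three polynomials in k − 1 variables that again sign-represent
-- parity up to a global sign. Each monomial of the original contributes to at most two of them.
-- Hence 3ⁿ ≤ 2ⁿ·size, i.e. 2ⁿ ≤ size².

module Submission where

open import Defs

open import Data.Bool using (Bool; true; false; not; _∧_; _∨_; _xor_; if_then_else_; T)
open import Data.Bool.Properties
  using (∧-assoc; ∧-identityʳ; ∧-zeroʳ; xor-assoc; xor-identityʳ; not-distribˡ-xor; not-distribʳ-xor; T-∧; T-≡)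
open import Data.Bool.ListAction using (any)
open import Data.Fin using (Fin; toℕ; zero; suc; fromℕ; inject₁)
open import Data.Fin.Properties using (toℕ-injective; toℕ<n)
open import Data.List using (List; []; _∷_; _++_; map; length; filterᵇ; deduplicateᵇ)
open import Data.List.Properties using (length-map)
open import Data.List.Membership.Propositional using (_∈_)
open import Data.List.Membership.Propositional.Properties using (∈-++⁺ˡ; ∈-++⁺ʳ; ∈-map⁺; ∈-filter⁻)
open import Data.List.Relation.Unary.All using (All; []; _∷_)
import Data.List.Relation.Unary.All as All
open import Data.List.Relation.Unary.All.Properties using (All¬⇒¬Any; ++⁺; concat⁺; map⁺)
open import Data.List.Relation.Unary.AllPairs.Core using (_∷_)
open import Data.List.Relation.Unary.Any using (Any; here; there)
import Data.List.Relation.Unary.Any as Any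
import Data.List.Relation.Unary.Any.Properties as Any
open import Data.List.Relation.Unary.Unique.DecSetoid using (Unique)
open import Data.List.Relation.Unary.Unique.DecSetoid.Properties using (deduplicate-!)
open import Data.Nat using (ℕ; zero; suc; _+_; _*_; _^_; _≤_; _<_; _≡ᵇ_; z≤n; s≤s)
open import Data.Nat.Properties
  using ( module ≤-Reasoning; ≤-trans; n≤1+n; <-trans; <-≤-trans; <⇒≢; >⇒≢; m≤m+n; suc-injective
        ; +-mono-≤; +-monoʳ-≤; +-monoʳ-<; +-cancelˡ-≡; *-mono-≤; *-monoʳ-≤; *-cancelˡ-≤; *-suc
        ; ^-monoˡ-≤; m^n≢0; ≡ᵇ⇒≡; ≡⇒≡ᵇ)
open import Data.Nat.Tactic.RingSolver using (solve-∀)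
open import Data.Product using (_×_; _,_; proj₁; proj₂; ∃₂)
open import Data.Rational using (ℚ; 0ℚ; 1ℚ; _≟_; nonNegative; nonPositive)
  renaming (_+_ to _+ℚ_; _*_ to _*ℚ_; -_ to -ℚ_; _-_ to _-ℚ_; _<_ to _<ℚ_; _≤_ to _≤ℚ_)
import Data.Rational.Properties as ℚ
open import Data.Rational.Solver using (module +-*-Solver)
open import Data.Sum using (_⊎_; inj₁; inj₂)
import Data.Sum as Sum
open import Data.Unit using (tt)
open import Data.Vec using (Vec; []; _∷_; lookup)
open import Function using (_∘_; id)
open import Function.Bundles using (Equivalence)
open import Level using (0ℓ)
open import Relation.Binary.Bundles using (DecSetoid)
open import Relation.Binary.PropositionalEquality
open import Relation.Nullary using (¬_; contradiction)
open import Relation.Nullary.Decidable using (T?; does; yes; no)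

-- Polynomials evaluated at Boolean points

toℚ : Bool → ℚ
toℚ true  = 1ℚ
toℚ false = 0ℚ

toℚ-∧ : ∀ a b → toℚ (a ∧ b) ≡ toℚ a *ℚ toℚ b
toℚ-∧ true  b = sym (ℚ.*-identityˡ (toℚ b))
toℚ-∧ false b = sym (ℚ.*-zeroˡ (toℚ b))

toℚ-idempotent : ∀ a → toℚ a *ℚ toℚ a -ℚ toℚ a ≡ 0ℚ
toℚ-idempotent true  = refl
toℚ-idempotent false = refl

toℚ-complementary : ∀ a → toℚ a +ℚ toℚ (not a) -ℚ 1ℚ ≡ 0ℚ
toℚ-complementary true  = refl
toℚ-complementary false = refl

T-injective : ∀ {a b : Bool} → (T a → T b) → (T b → T a) → a ≡ b
T-injective {false} {false} _ _ = refl
T-injective {false} {true}  _ b⇒a = contradiction tt b⇒a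
T-injective {true}  {false} a⇒b _ = contradiction tt a⇒b
T-injective {true}  {true}  _ _ = refl

module _ {A : Set} {x y : A} where

  if-T : ∀ b → T b → (if b then x else y) ≡ x
  if-T true _ = refl

  if-¬T : ∀ b → ¬ T b → (if b then x else y) ≡ y
  if-¬T true  ¬T = contradiction tt ¬T
  if-¬T false _  = refl

module _ {V : Set} (p : V → Bool) where

  allᵇ⁻ : ∀ (vs : List V) → T (allᵇ p vs) → All (T ∘ p) vs
  allᵇ⁻ []       _   = []
  allᵇ⁻ (v ∷ vs) pvs = let (pv , rest) = Equivalence.to T-∧ pvs in pv ∷ allᵇ⁻ vs rest

  allᵇ⁺ : ∀ {vs : List V} → All (T ∘ p) vs → T (allᵇ p vs)
  allᵇ⁺ []         = tt
  allᵇ⁺ (h ∷ rest) = Equivalence.from T-∧ (h , allᵇ⁺ rest)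

  allᵇ-⊆ : ∀ {vs ws : List V} → (∀ {w} → w ∈ ws → w ∈ vs) → T (allᵇ p vs) → T (allᵇ p ws)
  allᵇ-⊆ {vs} ws⊆vs pvs = allᵇ⁺ (All.tabulate (All.lookup (allᵇ⁻ vs pvs) ∘ ws⊆vs))

allᵇ-++ : ∀ {V : Set} (ρ : V → Bool) (m m′ : List V) → allᵇ ρ (m ++ m′) ≡ allᵇ ρ m ∧ allᵇ ρ m′
allᵇ-++ ρ []      m′ = refl
allᵇ-++ ρ (v ∷ m) m′ rewrite allᵇ-++ ρ m m′ = sym (∧-assoc (ρ v) (allᵇ ρ m) (allᵇ ρ m′))

∑ : {A : Set} → List A → (A → ℚ) → ℚ
∑ []       f = 0ℚ
∑ (a ∷ as) f = f a +ℚ ∑ as f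

module _ {A : Set} where

  ∑-cong : ∀ (xs : List A) {f g : A → ℚ} → (∀ {a} → a ∈ xs → f a ≡ g a) → ∑ xs f ≡ ∑ xs g
  ∑-cong []       f≗g = refl
  ∑-cong (a ∷ xs) f≗g = cong₂ _+ℚ_ (f≗g (here refl)) (∑-cong xs (f≗g ∘ there))

  ∑-zero : ∀ (xs : List A) {f : A → ℚ} → (∀ {a} → a ∈ xs → f a ≡ 0ℚ) → ∑ xs f ≡ 0ℚ
  ∑-zero []       f≗0 = refl
  ∑-zero (a ∷ xs) f≗0 rewrite f≗0 (here refl) | ∑-zero xs (f≗0 ∘ there) = refl

  ∑-++ : ∀ (xs ys : List A) (f : A → ℚ) → ∑ (xs ++ ys) f ≡ ∑ xs f +ℚ ∑ ys f
  ∑-++ []       ys f = sym (ℚ.+-identityˡ _)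
  ∑-++ (a ∷ xs) ys f rewrite ∑-++ xs ys f = sym (ℚ.+-assoc (f a) _ _)

  ∑-+ : ∀ (xs : List A) (f g : A → ℚ) → ∑ xs (λ a → f a +ℚ g a) ≡ ∑ xs f +ℚ ∑ xs g
  ∑-+ []       f g = sym (ℚ.+-identityˡ 0ℚ)
  ∑-+ (a ∷ xs) f g rewrite ∑-+ xs f g =
    solve 4 (λ p q r s → (p :+ q) :+ (r :+ s) := (p :+ r) :+ (q :+ s)) refl (f a) (g a) (∑ xs f) (∑ xs g)
    where open +-*-Solver

  ∑-*ˡ : ∀ (xs : List A) (c : ℚ) (f : A → ℚ) → ∑ xs (λ a → c *ℚ f a) ≡ c *ℚ ∑ xs f
  ∑-*ˡ []       c f = sym (ℚ.*-zeroʳ c)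
  ∑-*ˡ (a ∷ xs) c f rewrite ∑-*ˡ xs c f = sym (ℚ.*-distribˡ-+ c (f a) (∑ xs f))

  ∑-map : ∀ {B : Set} (h : B → A) (xs : List B) (f : A → ℚ) → ∑ (map h xs) f ≡ ∑ xs (f ∘ h)
  ∑-map h []       f = refl
  ∑-map h (b ∷ xs) f = cong (f (h b) +ℚ_) (∑-map h xs f)

  ∑-filterᵇ : ∀ (p : A → Bool) (xs : List A) (f : A → ℚ) →
              (∀ a → p a ≡ false → f a ≡ 0ℚ) → ∑ (filterᵇ p xs) f ≡ ∑ xs f
  ∑-filterᵇ p []       f dropped = refl
  ∑-filterᵇ p (a ∷ xs) f dropped with p a in pa
  ... | true  = cong (f a +ℚ_) (∑-filterᵇ p xs f dropped)
  ... | false = begin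
    ∑ (filterᵇ p xs) f    ≡⟨ ∑-filterᵇ p xs f dropped ⟩
    ∑ xs f                ≡⟨ ℚ.+-identityˡ (∑ xs f) ⟨
    0ℚ +ℚ ∑ xs f          ≡⟨ cong (_+ℚ ∑ xs f) (dropped a pa) ⟨
    f a +ℚ ∑ xs f         ∎
    where open ≡-Reasoning

  ∑-nonNegative : ∀ (xs : List A) {f : A → ℚ} → (∀ a → 0ℚ ≤ℚ f a) → 0ℚ ≤ℚ ∑ xs f
  ∑-nonNegative []       f≥0 = ℚ.≤-refl
  ∑-nonNegative (a ∷ xs) f≥0 = ℚ.+-mono-≤ (f≥0 a) (∑-nonNegative xs f≥0)

minus-+-interchange : ∀ a b c d → (a -ℚ b) +ℚ (c -ℚ d) ≡ (a +ℚ c) -ℚ (b +ℚ d)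
minus-+-interchange = solve 4 (λ a b c d → (a :- b) :+ (c :- d) := (a :+ c) :- (b :+ d)) refl
  where open +-*-Solver

square-nonNegative : ∀ a → 0ℚ ≤ℚ a *ℚ a
square-nonNegative a with ℚ.≤-total 0ℚ a
... | inj₁ 0≤a = ℚ.nonNegative⁻¹ _ {{ℚ.nonNeg*nonNeg⇒nonNeg a {{nonNegative 0≤a}} a {{nonNegative 0≤a}}}}
... | inj₂ a≤0 = ℚ.nonNegative⁻¹ _ {{ℚ.nonPos*nonPos⇒nonPos a {{nonPositive a≤0}} a {{nonPositive a≤0}}}}

monomialValue : {V : Set} → (V → Bool) → List V → ℚ
monomialValue ρ m = toℚ (allᵇ ρ m)

termValue : {V : Set} → (V → Bool) → ℚ × List V → ℚ
termValue ρ (c , m) = c *ℚ monomialValue ρ m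

eval : {V : Set} → (V → Bool) → List (ℚ × List V) → ℚ
eval ρ P = ∑ P (termValue ρ)

-- Literal polynomials that sign-represent parity

+₃-≤-2*suc : ∀ {l} a b c i j h → i + j + h ≡ 2 → a + b + c ≤ 2 * l → i + a + (j + b) + (h + c) ≤ 2 * suc l
+₃-≤-2*suc {l} a b c i j h i+j+h≡2 a+b+c≤2l = begin
  i + a + (j + b) + (h + c)   ≡⟨ regroup i j h a b c ⟩
  i + j + h + (a + b + c)     ≡⟨ cong (_+ (a + b + c)) i+j+h≡2 ⟩
  2 + (a + b + c)             ≤⟨ +-monoʳ-≤ 2 a+b+c≤2l ⟩
  2 + 2 * l                   ≡⟨ *-suc 2 l ⟨
  2 * suc l                   ∎
  where
  open ≤-Reasoning
  regroup : ∀ i j h a b c → i + a + (j + b) + (h + c) ≡ i + j + h + (a + b + c)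
  regroup = solve-∀

Literal : ℕ → Set
Literal k = Bool × Fin k

holds : Bool → Bool → Bool
holds s b = if s then b else not b

literalValue : ∀ {k} → Vec Bool k → Literal k → Bool
literalValue β (s , i) = holds s (lookup β i)

LitPoly : ℕ → Set
LitPoly k = List (ℚ × List (Literal k))

module _ {k : ℕ} where

  survives : Bool → List (Literal (suc k)) → Bool
  survives b []                = true
  survives b ((s , zero) ∷ d)  = holds s b ∧ survives b d
  survives b ((s , suc _) ∷ d) = survives b d

  dropHead : List (Literal (suc k)) → List (Literal k)
  dropHead []                = []
  dropHead ((s , zero) ∷ d)  = dropHead d
  dropHead ((s , suc i) ∷ d) = (s , i) ∷ dropHead d

  allᵇ-literalValue-∷ : ∀ (b : Bool) (β : Vec Bool k) (d : List (Literal (suc k))) →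
    allᵇ (literalValue (b ∷ β)) d ≡ survives b d ∧ allᵇ (literalValue β) (dropHead d)
  allᵇ-literalValue-∷ b β []                = refl
  allᵇ-literalValue-∷ b β ((s , zero) ∷ d)  rewrite allᵇ-literalValue-∷ b β d =
    sym (∧-assoc (holds s b) (survives b d) _)
  allᵇ-literalValue-∷ b β ((s , suc i) ∷ d) rewrite allᵇ-literalValue-∷ b β d with holds s (lookup β i)
  ... | true  = refl
  ... | false = sym (∧-zeroʳ (survives b d))

  restrictHead : Bool → LitPoly (suc k) → LitPoly k
  restrictHead b []            = []
  restrictHead b ((c , d) ∷ L) =
    if survives b d then (c , dropHead d) ∷ restrictHead b L else restrictHead b L

  derivativeTerm : Bool → Bool → ℚ × List (Literal k) → LitPoly k
  derivativeTerm true  false (c , d) = (c , d) ∷ []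
  derivativeTerm false true  (c , d) = (-ℚ c , d) ∷ []
  derivativeTerm _     _     _       = []

  derivativeHead : LitPoly (suc k) → LitPoly k
  derivativeHead []            = []
  derivativeHead ((c , d) ∷ L) =
    derivativeTerm (survives true d) (survives false d) (c , dropHead d) ++ derivativeHead L

  eval-restrictHead : ∀ (b : Bool) (β : Vec Bool k) (L : LitPoly (suc k)) →
    eval (literalValue β) (restrictHead b L) ≡ eval (literalValue (b ∷ β)) L
  eval-restrictHead b β []            = refl
  eval-restrictHead b β ((c , d) ∷ L) rewrite allᵇ-literalValue-∷ b β d with survives b d
  ... | true  = cong (c *ℚ monomialValue (literalValue β) (dropHead d) +ℚ_) (eval-restrictHead b β L)
  ... | false = begin
    eval (literalValue β) (restrictHead b L)   ≡⟨ eval-restrictHead b β L ⟩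
    eval (literalValue (b ∷ β)) L               ≡⟨ ℚ.+-identityˡ _ ⟨
    0ℚ +ℚ eval (literalValue (b ∷ β)) L         ≡⟨ cong (_+ℚ _) (ℚ.*-zeroʳ c) ⟨
    c *ℚ 0ℚ +ℚ eval (literalValue (b ∷ β)) L    ∎
    where open ≡-Reasoning

  eval-derivativeTerm : ∀ (β : Vec Bool k) (c : ℚ) (d : List (Literal (suc k))) →
    eval (literalValue β) (derivativeTerm (survives true d) (survives false d) (c , dropHead d))
      ≡ termValue (literalValue (true ∷ β)) (c , d) -ℚ termValue (literalValue (false ∷ β)) (c , d)
  eval-derivativeTerm β c d
    rewrite allᵇ-literalValue-∷ true β d | allᵇ-literalValue-∷ false β d
    with survives true d | survives false d
  ... | true  | true  = sym (ℚ.+-inverseʳ (c *ℚ monomialValue (literalValue β) (dropHead d)))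
  ... | true  | false =
    solve 2 (λ c v → c :* v :+ con 0ℚ := c :* v :- c :* con 0ℚ) refl c (monomialValue (literalValue β) (dropHead d))
    where open +-*-Solver
  ... | false | true  =
    solve 2 (λ c v → (:- c) :* v :+ con 0ℚ := c :* con 0ℚ :- c :* v) refl c (monomialValue (literalValue β) (dropHead d))
    where open +-*-Solver
  ... | false | false = sym (ℚ.+-inverseʳ (c *ℚ 0ℚ))

  eval-derivativeHead : ∀ (β : Vec Bool k) (L : LitPoly (suc k)) →
    eval (literalValue β) (derivativeHead L) ≡ eval (literalValue (true ∷ β)) L -ℚ eval (literalValue (false ∷ β)) L
  eval-derivativeHead β []            = sym (ℚ.+-inverseʳ 0ℚ)
  eval-derivativeHead β ((c , d) ∷ L) = begin
    eval (literalValue β) (derivativeTerm s₁ s₀ (c , dropHead d) ++ derivativeHead L)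
      ≡⟨ ∑-++ (derivativeTerm s₁ s₀ (c , dropHead d)) (derivativeHead L) (termValue (literalValue β)) ⟩
    eval (literalValue β) (derivativeTerm s₁ s₀ (c , dropHead d)) +ℚ eval (literalValue β) (derivativeHead L)
      ≡⟨ cong₂ _+ℚ_ (eval-derivativeTerm β c d) (eval-derivativeHead β L) ⟩
    (termValue ρ₁ (c , d) -ℚ termValue ρ₀ (c , d)) +ℚ (eval ρ₁ L -ℚ eval ρ₀ L)
      ≡⟨ minus-+-interchange (termValue ρ₁ (c , d)) (termValue ρ₀ (c , d)) (eval ρ₁ L) (eval ρ₀ L) ⟩
    eval ρ₁ ((c , d) ∷ L) -ℚ eval ρ₀ ((c , d) ∷ L) ∎
    where
    open ≡-Reasoning
    s₁ s₀ : Bool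
    s₁ = survives true d
    s₀ = survives false d
    ρ₁ ρ₀ : Literal (suc k) → Bool
    ρ₁ = literalValue (true ∷ β)
    ρ₀ = literalValue (false ∷ β)

  private
    length-∷-bound : ∀ (L : LitPoly (suc k)) i j h → i + j + h ≡ 2 →
      length (restrictHead true L) + length (restrictHead false L) + length (derivativeHead L) ≤ 2 * length L →
      i + length (restrictHead true L) + (j + length (restrictHead false L)) + (h + length (derivativeHead L))
        ≤ 2 * suc (length L)
    length-∷-bound L =
      +₃-≤-2*suc (length (restrictHead true L)) (length (restrictHead false L)) (length (derivativeHead L))

  length-restrictHead-derivativeHead : ∀ (L : LitPoly (suc k)) →
    length (restrictHead true L) + length (restrictHead false L) + length (derivativeHead L) ≤ 2 * length L
  length-restrictHead-derivativeHead []            = z≤n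
  length-restrictHead-derivativeHead ((c , d) ∷ L)
    with survives true d | survives false d | length-restrictHead-derivativeHead L
  ... | true  | true  | ih = length-∷-bound L 1 1 0 refl ih
  ... | true  | false | ih = length-∷-bound L 1 0 1 refl ih
  ... | false | true  | ih = length-∷-bound L 0 1 1 refl ih
  ... | false | false | ih = ≤-trans ih (*-monoʳ-≤ 2 (n≤1+n (length L)))

HasSign : Bool → ℚ → Set
HasSign true  q = 0ℚ <ℚ q
HasSign false q = q <ℚ 0ℚ

¬HasSign-0 : ∀ s → ¬ HasSign s 0ℚ
¬HasSign-0 true  = ℚ.<-irrefl refl
¬HasSign-0 false = ℚ.<-irrefl refl

0<s+1 : ∀ {s} → 0ℚ ≤ℚ s → 0ℚ <ℚ s +ℚ 1ℚ
0<s+1 0≤s = ℚ.+-mono-≤-< 0≤s (ℚ.positive⁻¹ 1ℚ)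

HasSign-minus : ∀ s {a b} → HasSign (not s) a → HasSign s b → HasSign (not s) (a -ℚ b)
HasSign-minus false {a} {b} 0<a b<0 =
  subst (_<ℚ a -ℚ b) (ℚ.+-identityʳ 0ℚ) (ℚ.+-mono-< 0<a (ℚ.neg-antimono-< b<0))
HasSign-minus true  {a} {b} a<0 0<b =
  subst (a -ℚ b <ℚ_) (ℚ.+-identityʳ 0ℚ) (ℚ.+-mono-< a<0 (ℚ.neg-antimono-< 0<b))

parity : ∀ {k} → Vec Bool k → Bool
parity []      = false
parity (b ∷ β) = b xor parity β

SignRepresentsParity : Bool → ∀ k → LitPoly k → Set
SignRepresentsParity σ k L = ∀ (β : Vec Bool k) → HasSign (σ xor parity β) (eval (literalValue β) L)

module _ {k : ℕ} (σ : Bool) (L : LitPoly (suc k)) (L±parity : SignRepresentsParity σ (suc k) L) where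

  SignRepresentsParity-restrictHead : ∀ b → SignRepresentsParity (σ xor b) k (restrictHead b L)
  SignRepresentsParity-restrictHead b β =
    subst₂ HasSign (sym (xor-assoc σ b (parity β))) (sym (eval-restrictHead b β L)) (L±parity (b ∷ β))

  SignRepresentsParity-derivativeHead : SignRepresentsParity (not σ) k (derivativeHead L)
  SignRepresentsParity-derivativeHead β =
    subst₂ HasSign (not-distribˡ-xor σ (parity β)) (sym (eval-derivativeHead β L))
      (HasSign-minus (σ xor parity β)
        (subst (λ s → HasSign s _) (sym (not-distribʳ-xor σ (parity β))) (L±parity (true ∷ β)))
        (L±parity (false ∷ β)))

SignRepresentsParity⇒length : ∀ σ k (L : LitPoly k) → SignRepresentsParity σ k L → 3 ^ k ≤ 2 ^ k * length L
SignRepresentsParity⇒length σ zero    []      L±parity = contradiction (L±parity []) (¬HasSign-0 (σ xor false))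
SignRepresentsParity⇒length σ zero    (_ ∷ _) L±parity = s≤s z≤n
SignRepresentsParity⇒length σ (suc k) L       L±parity = begin
  3 ^ suc k                                                  ≡⟨ three-times (3 ^ k) ⟩
  3 ^ k + 3 ^ k + 3 ^ k                                      ≤⟨ +-mono-≤ (+-mono-≤ bound₁ bound₀) boundΔ ⟩
  2 ^ k * length L₁ + 2 ^ k * length L₀ + 2 ^ k * length LΔ
    ≡⟨ factor (2 ^ k) (length L₁) (length L₀) (length LΔ) ⟩
  2 ^ k * (length L₁ + length L₀ + length LΔ)
    ≤⟨ *-monoʳ-≤ (2 ^ k) (length-restrictHead-derivativeHead L) ⟩
  2 ^ k * (2 * length L)                                     ≡⟨ reorder (2 ^ k) (length L) ⟩
  2 ^ suc k * length L                                       ∎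
  where
  open ≤-Reasoning
  L₁ L₀ LΔ : LitPoly k
  L₁ = restrictHead true L
  L₀ = restrictHead false L
  LΔ = derivativeHead L
  bound₁ : 3 ^ k ≤ 2 ^ k * length L₁
  bound₁ = SignRepresentsParity⇒length (σ xor true) k L₁ (SignRepresentsParity-restrictHead σ L L±parity true)
  bound₀ : 3 ^ k ≤ 2 ^ k * length L₀
  bound₀ = SignRepresentsParity⇒length (σ xor false) k L₀ (SignRepresentsParity-restrictHead σ L L±parity false)
  boundΔ : 3 ^ k ≤ 2 ^ k * length LΔ
  boundΔ = SignRepresentsParity⇒length (not σ) k LΔ (SignRepresentsParity-derivativeHead σ L L±parity)
  three-times : ∀ x → 3 * x ≡ x + x + x
  three-times = solve-∀
  factor : ∀ y a b c → y * a + y * b + y * c ≡ y * (a + b + c)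
  factor = solve-∀
  reorder : ∀ y l → y * (2 * l) ≡ 2 * y * l
  reorder = solve-∀

-- Evaluating the encoded polynomials

module _ {n : ℕ} (ρ : PVar n → Bool) where

  eval-+P : ∀ (p q : Poly n) → eval ρ (p +P q) ≡ eval ρ p +ℚ eval ρ q
  eval-+P p q = ∑-++ p q (termValue ρ)

  eval-negP : ∀ (p : Poly n) → eval ρ (negP p) ≡ -ℚ eval ρ p
  eval-negP []            = refl
  eval-negP ((c , m) ∷ p) rewrite eval-negP p =
    solve 3 (λ c v e → (:- c) :* v :+ (:- e) := :- (c :* v :+ e)) refl c (monomialValue ρ m) (eval ρ p)
    where open +-*-Solver

  eval-minusP : ∀ (p q : Poly n) → eval ρ (p -P q) ≡ eval ρ p -ℚ eval ρ q
  eval-minusP p q = trans (eval-+P p (negP q)) (cong (eval ρ p +ℚ_) (eval-negP q))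

  eval-scale : ∀ (c : ℚ) (m : Monomial n) (q : Poly n) →
               eval ρ (map (λ b → (c *ℚ proj₁ b , m ++ proj₂ b)) q) ≡ (c *ℚ monomialValue ρ m) *ℚ eval ρ q
  eval-scale c m q = begin
    eval ρ (map (λ b → (c *ℚ proj₁ b , m ++ proj₂ b)) q)
      ≡⟨ ∑-map (λ b → (c *ℚ proj₁ b , m ++ proj₂ b)) q (termValue ρ) ⟩
    ∑ q (λ (c′ , m′) → (c *ℚ c′) *ℚ monomialValue ρ (m ++ m′))
      ≡⟨ ∑-cong q (λ {(c′ , m′)} _ → distribute c′ m′) ⟩
    ∑ q (λ b → (c *ℚ monomialValue ρ m) *ℚ termValue ρ b)
      ≡⟨ ∑-*ˡ q (c *ℚ monomialValue ρ m) (termValue ρ) ⟩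
    (c *ℚ monomialValue ρ m) *ℚ eval ρ q ∎
    where
    open ≡-Reasoning
    open +-*-Solver
    distribute : ∀ c′ m′ → (c *ℚ c′) *ℚ monomialValue ρ (m ++ m′)
                         ≡ (c *ℚ monomialValue ρ m) *ℚ (c′ *ℚ monomialValue ρ m′)
    distribute c′ m′ rewrite allᵇ-++ ρ m m′ | toℚ-∧ (allᵇ ρ m) (allᵇ ρ m′) =
      solve 4 (λ c c′ v v′ → (c :* c′) :* (v :* v′) := (c :* v) :* (c′ :* v′)) refl
        c c′ (monomialValue ρ m) (monomialValue ρ m′)

  eval-*P : ∀ (p q : Poly n) → eval ρ (p *P q) ≡ eval ρ p *ℚ eval ρ q
  eval-*P []            q = sym (ℚ.*-zeroˡ (eval ρ q))
  eval-*P ((c , m) ∷ p) q = begin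
    eval ρ (map (λ b → (c *ℚ proj₁ b , m ++ proj₂ b)) q ++ p *P q)
      ≡⟨ ∑-++ (map (λ b → (c *ℚ proj₁ b , m ++ proj₂ b)) q) (p *P q) (termValue ρ) ⟩
    eval ρ (map (λ b → (c *ℚ proj₁ b , m ++ proj₂ b)) q) +ℚ eval ρ (p *P q)
      ≡⟨ cong₂ _+ℚ_ (eval-scale c m q) (eval-*P p q) ⟩
    (c *ℚ monomialValue ρ m) *ℚ eval ρ q +ℚ eval ρ p *ℚ eval ρ q
      ≡⟨ ℚ.*-distribʳ-+ (eval ρ q) (c *ℚ monomialValue ρ m) (eval ρ p) ⟨
    (c *ℚ monomialValue ρ m +ℚ eval ρ p) *ℚ eval ρ q ∎
    where open ≡-Reasoning

  eval-const : ∀ c → eval ρ (const c) ≡ c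
  eval-const c = trans (ℚ.+-identityʳ _) (ℚ.*-identityʳ c)

  eval-var : ∀ v → eval ρ (var v) ≡ toℚ (ρ v)
  eval-var v rewrite ∧-identityʳ (ρ v) = trans (ℚ.+-identityʳ _) (ℚ.*-identityˡ _)

  eval-sumP : ∀ (ps : List (Poly n)) → eval ρ (sumP ps) ≡ ∑ ps (eval ρ)
  eval-sumP []       = refl
  eval-sumP (p ∷ ps) = trans (eval-+P p (sumP ps)) (cong (eval ρ p +ℚ_) (eval-sumP ps))

  eval-sos-nonNegative : ∀ (ss : List (Poly n)) → 0ℚ ≤ℚ eval ρ (sos ss)
  eval-sos-nonNegative ss =
    subst (0ℚ ≤ℚ_) (sym (trans (eval-sumP (map (λ s → s *P s) ss)) (∑-map _ ss (eval ρ))))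
      (∑-nonNegative ss (λ s → subst (0ℚ ≤ℚ_) (sym (eval-*P s s)) (square-nonNegative (eval ρ s))))

-- Collecting like terms

module _ {n : ℕ} where

  u<t : ∀ (j : Fin n) → codeVar {n} u < codeVar (t j)
  u<t j = s≤s (m≤m+n n (toℕ j))

  x<u : ∀ (i : Fin n) → codeVar (x i) < codeVar {n} u
  x<u = toℕ<n

  codeVar-injective : ∀ {v w : Var n} → codeVar v ≡ codeVar w → v ≡ w
  codeVar-injective {x i} {x j} e = cong x (toℕ-injective e)
  codeVar-injective {x i} {u}   e = contradiction e (<⇒≢ (x<u i))
  codeVar-injective {x i} {t j} e = contradiction e (<⇒≢ (<-trans (x<u i) (u<t j)))
  codeVar-injective {u}   {x j} e = contradiction e (>⇒≢ (x<u j))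
  codeVar-injective {u}   {u}   e = refl
  codeVar-injective {u}   {t j} e = contradiction e (<⇒≢ (u<t j))
  codeVar-injective {t i} {x j} e = contradiction e (>⇒≢ (<-trans (x<u j) (u<t i)))
  codeVar-injective {t i} {u}   e = contradiction e (>⇒≢ (u<t i))
  codeVar-injective {t i} {t j} e = cong t (toℕ-injective (+-cancelˡ-≡ n _ _ (suc-injective e)))

  codeVar<codeTwin : ∀ (v : Var n) → codeVar v < suc (n + n)
  codeVar<codeTwin (x i) = <-trans (x<u i) (s≤s (m≤m+n n n))
  codeVar<codeTwin u     = s≤s (m≤m+n n n)
  codeVar<codeTwin (t i) = s≤s (+-monoʳ-< n (toℕ<n i))

  code-injective : ∀ {v w : PVar n} → code v ≡ code w → v ≡ w
  code-injective {plain v} {plain w} e = cong plain (codeVar-injective e)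
  code-injective {plain v} {twin w}  e = contradiction e (<⇒≢ (<-≤-trans (codeVar<codeTwin v) (m≤m+n _ _)))
  code-injective {twin v}  {plain w} e = contradiction e (>⇒≢ (<-≤-trans (codeVar<codeTwin w) (m≤m+n _ _)))
  code-injective {twin v}  {twin w}  e = cong twin (codeVar-injective (+-cancelˡ-≡ (suc (n + n)) _ _ e))

  ==⇒≡ : ∀ {v w : PVar n} → T (v == w) → v ≡ w
  ==⇒≡ {v} {w} v==w = code-injective (≡ᵇ⇒≡ (code v) (code w) v==w)

  ==-refl : ∀ (v : PVar n) → T (v == v)
  ==-refl v = ≡⇒≡ᵇ (code v) (code v) refl

  count≡0⊎∈ : ∀ (v : PVar n) (m : Monomial n) → count v m ≡ 0 ⊎ v ∈ m
  count≡0⊎∈ v []      = inj₁ refl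
  count≡0⊎∈ v (w ∷ m) with v == w | ==⇒≡ {v = v} {w}
  ... | true  | v≡w = inj₂ (here (v≡w tt))
  ... | false | _   = Sum.map id there (count≡0⊎∈ v m)

  ∈⇒count≢0 : ∀ {v : PVar n} {m : Monomial n} → v ∈ m → count v m ≢ 0
  ∈⇒count≢0 {v} (here refl) with v == v | ==-refl v
  ... | true | _ = λ ()
  ∈⇒count≢0 {v} {w ∷ m} (there v∈m) with v == w
  ... | true  = λ ()
  ... | false = ∈⇒count≢0 v∈m

  _≈ₘ_ : Monomial n → Monomial n → Set
  m ≈ₘ m′ = T (monoEq m m′)

  ≈ₘ⇒count≡-on : ∀ {m m′ : Monomial n} → m ≈ₘ m′ →
                 ∀ {v} → v ∈ m ++ m′ → count v m ≡ count v m′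
  ≈ₘ⇒count≡-on {m} {m′} m≈m′ v∈ =
    ≡ᵇ⇒≡ _ _ (All.lookup (allᵇ⁻ (λ w → count w m ≡ᵇ count w m′) (m ++ m′) m≈m′) v∈)

  ≈ₘ⇒count≡ : ∀ {m m′ : Monomial n} → m ≈ₘ m′ → ∀ v → count v m ≡ count v m′
  ≈ₘ⇒count≡ {m} {m′} m≈m′ v with count≡0⊎∈ v m | count≡0⊎∈ v m′
  ... | inj₁ c≡0 | inj₁ c′≡0 = trans c≡0 (sym c′≡0)
  ... | inj₂ v∈m | _         = ≈ₘ⇒count≡-on {m} {m′} m≈m′ (∈-++⁺ˡ v∈m)
  ... | inj₁ _   | inj₂ v∈m′ = ≈ₘ⇒count≡-on {m} {m′} m≈m′ (∈-++⁺ʳ m v∈m′)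

  count≡⇒≈ₘ : ∀ {m m′ : Monomial n} → (∀ v → count v m ≡ count v m′) → m ≈ₘ m′
  count≡⇒≈ₘ {m} {m′} same =
    allᵇ⁺ (λ w → count w m ≡ᵇ count w m′) {m ++ m′} (All.tabulate (λ {v} _ → ≡⇒≡ᵇ _ _ (same v)))

  monomialDecSetoid : DecSetoid 0ℓ 0ℓ
  monomialDecSetoid = record
    { Carrier          = Monomial n
    ; _≈_              = _≈ₘ_
    ; isDecEquivalence = record
      { isEquivalence = record
        { refl  = λ {m} → count≡⇒≈ₘ {m} {m} (λ _ → refl)
        ; sym   = λ {m} {m′} m≈m′ → count≡⇒≈ₘ {m′} {m} (λ v → sym (≈ₘ⇒count≡ {m} {m′} m≈m′ v))
        ; trans = λ {m} {m′} {m″} m≈m′ m′≈m″ → count≡⇒≈ₘ {m} {m″}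
                    (λ v → trans (≈ₘ⇒count≡ {m} {m′} m≈m′ v) (≈ₘ⇒count≡ {m′} {m″} m′≈m″ v))
        }
      ; _≟_ = λ m m′ → T? (monoEq m m′)
      }
    }

  open DecSetoid monomialDecSetoid using () renaming (refl to ≈ₘ-refl; sym to ≈ₘ-sym; trans to ≈ₘ-trans)

  ≈ₘ⇒⊆ : ∀ {m m′ : Monomial n} → m ≈ₘ m′ → ∀ {v} → v ∈ m → v ∈ m′
  ≈ₘ⇒⊆ {m} {m′} m≈m′ {v} v∈m with count≡0⊎∈ v m′
  ... | inj₁ c≡0  = contradiction (trans (≈ₘ⇒count≡ {m} {m′} m≈m′ v) c≡0) (∈⇒count≢0 v∈m)
  ... | inj₂ v∈m′ = v∈m′

  monomialValue-resp-≈ₘ : ∀ (ρ : PVar n → Bool) {m m′ : Monomial n} →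
                          m ≈ₘ m′ → monomialValue ρ m ≡ monomialValue ρ m′
  monomialValue-resp-≈ₘ ρ {m} {m′} m≈m′ = cong toℚ (T-injective
    (allᵇ-⊆ ρ (≈ₘ⇒⊆ {m′} {m} (≈ₘ-sym {m} {m′} m≈m′)))
    (allᵇ-⊆ ρ (≈ₘ⇒⊆ {m} {m′} m≈m′)))

  coeff-∷ : ∀ (c : ℚ) (m : Monomial n) (p : Poly n) (d : Monomial n) →
            coeff ((c , m) ∷ p) d ≡ (if monoEq m d then c else 0ℚ) +ℚ coeff p d
  coeff-∷ c m p d with monoEq m d
  ... | true  = refl
  ... | false = sym (ℚ.+-identityˡ (coeff p d))

  module _ (ρ : PVar n → Bool) (c : ℚ) (m : Monomial n) where

    private
      weight : Monomial n → ℚ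
      weight d = (if monoEq m d then c else 0ℚ) *ℚ monomialValue ρ d

    weight-≈ₘ : ∀ {d} → m ≈ₘ d → weight d ≡ c *ℚ monomialValue ρ m
    weight-≈ₘ {d} m≈d =
      cong₂ _*ℚ_ (if-T (monoEq m d) m≈d) (sym (monomialValue-resp-≈ₘ ρ {m} {d} m≈d))

    weight-≉ₘ : ∀ {d} → ¬ m ≈ₘ d → weight d ≡ 0ℚ
    weight-≉ₘ {d} m≉d =
      trans (cong (_*ℚ monomialValue ρ d) (if-¬T (monoEq m d) m≉d)) (ℚ.*-zeroˡ (monomialValue ρ d))

    ∑-weight : ∀ {D : List (Monomial n)} → Unique monomialDecSetoid D → Any (m ≈ₘ_) D →
               ∑ D weight ≡ c *ℚ monomialValue ρ m
    ∑-weight {d ∷ D} (d≉D ∷ _) (here m≈d) = begin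
      weight d +ℚ ∑ D weight        ≡⟨ cong₂ _+ℚ_ (weight-≈ₘ m≈d) (∑-zero D (weight-≉ₘ ∘ m≉D)) ⟩
      c *ℚ monomialValue ρ m +ℚ 0ℚ  ≡⟨ ℚ.+-identityʳ _ ⟩
      c *ℚ monomialValue ρ m        ∎
      where
      open ≡-Reasoning
      m≉D : ∀ {d′} → d′ ∈ D → ¬ m ≈ₘ d′
      m≉D {d′} d′∈D m≈d′ = All.lookup d≉D d′∈D (≈ₘ-trans {d} {m} {d′} (≈ₘ-sym {m} {d} m≈d) m≈d′)
    ∑-weight {d ∷ D} (d≉D ∷ uniq) (there m≈D) = begin
      weight d +ℚ ∑ D weight        ≡⟨ cong₂ _+ℚ_ (weight-≉ₘ m≉d) (∑-weight uniq m≈D) ⟩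
      0ℚ +ℚ c *ℚ monomialValue ρ m  ≡⟨ ℚ.+-identityˡ _ ⟩
      c *ℚ monomialValue ρ m        ∎
      where
      open ≡-Reasoning
      m≉d : ¬ m ≈ₘ d
      m≉d m≈d = All¬⇒¬Any d≉D (Any.map (≈ₘ-trans {d} {m} (≈ₘ-sym {m} {d} m≈d)) m≈D)

  eval-as-∑-coeff : ∀ (ρ : PVar n → Bool) (p : Poly n) {D : List (Monomial n)} →
                    Unique monomialDecSetoid D → All (λ (_ , m) → Any (m ≈ₘ_) D) p →
                    eval ρ p ≡ ∑ D (λ d → coeff p d *ℚ monomialValue ρ d)
  eval-as-∑-coeff ρ []            {D} _    _                 =
    sym (∑-zero D (λ {d} _ → ℚ.*-zeroˡ (monomialValue ρ d)))
  eval-as-∑-coeff ρ ((c , m) ∷ p) {D} uniq (m∈D ∷ covered) = begin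
    c *ℚ monomialValue ρ m +ℚ eval ρ p
      ≡⟨ cong₂ _+ℚ_ (sym (∑-weight ρ c m uniq m∈D)) (eval-as-∑-coeff ρ p uniq covered) ⟩
    ∑ D (λ d → (if monoEq m d then c else 0ℚ) *ℚ monomialValue ρ d)
      +ℚ ∑ D (λ d → coeff p d *ℚ monomialValue ρ d)
      ≡⟨ ∑-+ D _ _ ⟨
    ∑ D (λ d → (if monoEq m d then c else 0ℚ) *ℚ monomialValue ρ d +ℚ coeff p d *ℚ monomialValue ρ d)
      ≡⟨ ∑-cong D (λ {d} _ → collect d) ⟩
    ∑ D (λ d → coeff ((c , m) ∷ p) d *ℚ monomialValue ρ d) ∎
    where
    open ≡-Reasoning
    collect : ∀ d → (if monoEq m d then c else 0ℚ) *ℚ monomialValue ρ d +ℚ coeff p d *ℚ monomialValue ρ d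
                  ≡ coeff ((c , m) ∷ p) d *ℚ monomialValue ρ d
    collect d = trans (sym (ℚ.*-distribʳ-+ (monomialValue ρ d) (if monoEq m d then c else 0ℚ) (coeff p d)))
                      (cong (_*ℚ monomialValue ρ d) (sym (coeff-∷ c m p d)))

  distinctMonomials : Poly n → List (Monomial n)
  distinctMonomials p = deduplicateᵇ monoEq (map proj₂ p)

  hasNonzeroCoeff : Poly n → Monomial n → Bool
  hasNonzeroCoeff p d = not (does (coeff p d ≟ 0ℚ))

  support : Poly n → List (Monomial n)
  support p = filterᵇ (hasNonzeroCoeff p) (distinctMonomials p)

  support-coeff≢0 : ∀ (p : Poly n) {d} → d ∈ support p → coeff p d ≢ 0ℚ
  support-coeff≢0 p {d} d∈
    with coeff p d ≟ 0ℚ | proj₂ (∈-filter⁻ (T? ∘ hasNonzeroCoeff p) {xs = distinctMonomials p} d∈)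
  ... | no c≢0 | _ = c≢0

  eval-support : ∀ (ρ : PVar n → Bool) (p : Poly n) →
                 eval ρ p ≡ ∑ (support p) (λ d → coeff p d *ℚ monomialValue ρ d)
  eval-support ρ p = begin
    eval ρ p
      ≡⟨ eval-as-∑-coeff ρ p (deduplicate-! monomialDecSetoid (map proj₂ p)) (All.tabulate covered) ⟩
    ∑ (distinctMonomials p) weight
      ≡⟨ ∑-filterᵇ (hasNonzeroCoeff p) (distinctMonomials p) weight dropped ⟨
    ∑ (support p) weight ∎
    where
    open ≡-Reasoning
    weight : Monomial n → ℚ
    weight d = coeff p d *ℚ monomialValue ρ d
    covered : ∀ {cm : ℚ × Monomial n} → cm ∈ p → Any (proj₂ cm ≈ₘ_) (distinctMonomials p)
    covered {_ , m} cm∈p = Any.deduplicate⁺ (λ d d′ → T? (monoEq d d′))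
      (λ {d} {d′} d′≈d m≈d → ≈ₘ-trans {m} {d} {d′} m≈d (≈ₘ-sym {d′} {d} d′≈d))
      (Any.map (λ { refl → ≈ₘ-refl {m} }) (∈-map⁺ proj₂ cm∈p))
    dropped : ∀ d → hasNonzeroCoeff p d ≡ false → weight d ≡ 0ℚ
    dropped d with coeff p d ≟ 0ℚ
    ... | yes c≡0 = λ _ → trans (cong (_*ℚ monomialValue ρ d) c≡0) (ℚ.*-zeroˡ (monomialValue ρ d))

  eval-IsZeroPoly : ∀ (ρ : PVar n → Bool) (p : Poly n) → IsZeroPoly p → eval ρ p ≡ 0ℚ
  eval-IsZeroPoly ρ p p≡0 = trans (eval-support ρ p)
    (∑-zero (support p) (λ {d} _ → trans (cong (_*ℚ monomialValue ρ d) (p≡0 d)) (ℚ.*-zeroˡ (monomialValue ρ d))))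

-- The parity assignment satisfies the matrix

complementary-literals : ∀ s {p q} → p ≡ q → T (holds (not s) p ∨ (holds s q ∨ false))
complementary-literals true  {true}  refl = tt
complementary-literals true  {false} refl = tt
complementary-literals false {true}  refl = tt
complementary-literals false {false} refl = tt

equal-literals : ∀ s {p q} → p ≡ not q → T (holds s p ∨ (holds s q ∨ false))
equal-literals true  {q = true}  refl = tt
equal-literals true  {q = false} refl = tt
equal-literals false {q = true}  refl = tt
equal-literals false {q = false} refl = tt

xor3-literals : ∀ α₀ β₀ p q {r} → r ≡ p xor q →
                T (holds (not α₀) p ∨ (holds (not β₀) q ∨ (holds (α₀ xor β₀) r ∨ false)))
xor3-literals false _     true  _     refl = tt
xor3-literals true  _     false _     refl = tt
xor3-literals false false false true  refl = tt
xor3-literals false true  false false refl = tt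
xor3-literals true  false true  true  refl = tt
xor3-literals true  true  true  false refl = tt
xor3-literals false false false false refl = tt
xor3-literals false true  false true  refl = tt
xor3-literals true  false true  false refl = tt
xor3-literals true  true  true  true  refl = tt

module _ {n : ℕ} (α : Var n → Bool) where

  withTwins : PVar n → Bool
  withTwins (plain v) = α v
  withTwins (twin v)  = not (α v)

  clauseValue : Clause n → Bool
  clauseValue = any (λ (s , v) → holds s (α v))

  Satisfies : Clause n → Set
  Satisfies C = T (clauseValue C)

  allᵇ-litFactor : ∀ (C : Clause n) → allᵇ withTwins (map litFactor C) ≡ not (clauseValue C)
  allᵇ-litFactor []            = refl
  allᵇ-litFactor ((true , v) ∷ C) rewrite allᵇ-litFactor C with α v
  ... | true  = refl
  ... | false = refl
  allᵇ-litFactor ((false , v) ∷ C) rewrite allᵇ-litFactor C with α v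
  ... | true  = refl
  ... | false = refl

  boolAx-vanishes : ∀ v → All (λ p → eval withTwins p ≡ 0ℚ) (boolAx v)
  boolAx-vanishes v = idempotent ∷ complementary ∷ []
    where
    open ≡-Reasoning
    a : Bool
    a = α v
    idempotent : eval withTwins (var (plain v) *P var (plain v) -P var (plain v)) ≡ 0ℚ
    idempotent = begin
      eval withTwins (var (plain v) *P var (plain v) -P var (plain v))
        ≡⟨ eval-minusP withTwins (var (plain v) *P var (plain v)) (var (plain v)) ⟩
      eval withTwins (var (plain v) *P var (plain v)) -ℚ eval withTwins (var (plain v))
        ≡⟨ cong (_-ℚ eval withTwins (var (plain v))) (eval-*P withTwins (var (plain v)) (var (plain v))) ⟩
      eval withTwins (var (plain v)) *ℚ eval withTwins (var (plain v)) -ℚ eval withTwins (var (plain v))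
        ≡⟨ cong (λ y → y *ℚ y -ℚ y) (eval-var withTwins (plain v)) ⟩
      toℚ a *ℚ toℚ a -ℚ toℚ a
        ≡⟨ toℚ-idempotent a ⟩
      0ℚ ∎
    complementary : eval withTwins (var (plain v) +P var (twin v) -P const 1ℚ) ≡ 0ℚ
    complementary = begin
      eval withTwins (var (plain v) +P var (twin v) -P const 1ℚ)
        ≡⟨ eval-minusP withTwins (var (plain v) +P var (twin v)) (const 1ℚ) ⟩
      eval withTwins (var (plain v) +P var (twin v)) -ℚ eval withTwins (const 1ℚ)
        ≡⟨ cong₂ _-ℚ_ (eval-+P withTwins (var (plain v)) (var (twin v))) (eval-const withTwins 1ℚ) ⟩
      eval withTwins (var (plain v)) +ℚ eval withTwins (var (twin v)) -ℚ 1ℚ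
        ≡⟨ cong₂ (λ y z → y +ℚ z -ℚ 1ℚ) (eval-var withTwins (plain v)) (eval-var withTwins (twin v)) ⟩
      toℚ a +ℚ toℚ (not a) -ℚ 1ℚ
        ≡⟨ toℚ-complementary a ⟩
      0ℚ ∎

  enc-vanishes : ∀ {C} → Satisfies C → All (λ p → eval withTwins p ≡ 0ℚ) (enc C)
  enc-vanishes {C} sat = clauseMonomial-vanishes ∷ concat⁺ (map⁺ (All.universal (boolAx-vanishes ∘ proj₂) C))
    where
    clauseMonomial-vanishes : eval withTwins ((1ℚ , map litFactor C) ∷ []) ≡ 0ℚ
    clauseMonomial-vanishes rewrite allᵇ-litFactor C | Equivalence.to T-≡ sat = refl

  encCNF-vanishes : ∀ {φ : CNF n} → All Satisfies φ → All (λ p → eval withTwins p ≡ 0ℚ) (encCNF φ)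
  encCNF-vanishes sats = concat⁺ (map⁺ (All.map enc-vanishes sats))

  iffCNF-satisfied : ∀ a b → α a ≡ α b → All Satisfies (iffCNF a b)
  iffCNF-satisfied a b e = complementary-literals true e ∷ complementary-literals false e ∷ []

  xorCNF-satisfied : ∀ a b → α a ≡ not (α b) → All Satisfies (xorCNF a b)
  xorCNF-satisfied a b e = equal-literals true e ∷ equal-literals false e ∷ []

  xor3CNF-satisfied : ∀ a b c → α c ≡ α a xor α b → All Satisfies (xor3CNF a b c)
  xor3CNF-satisfied a b c e =
    literals false false ∷ literals false true ∷ literals true false ∷ literals true true ∷ []
    where
    literals : ∀ α₀ β₀ → Satisfies (xor3Clause a b c α₀ β₀)
    literals α₀ β₀ = xor3-literals α₀ β₀ (α a) (α b) e

prefixParity : ∀ {n} → Vec Bool n → Fin n → Bool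
prefixParity (b ∷ β) zero    = b
prefixParity (b ∷ β) (suc i) = b xor prefixParity β i

prefixParity-fromℕ : ∀ {m} (β : Vec Bool (suc m)) → prefixParity β (fromℕ m) ≡ parity β
prefixParity-fromℕ {zero}  (b ∷ []) = sym (xor-identityʳ b)
prefixParity-fromℕ {suc m} (b ∷ β)  = cong (b xor_) (prefixParity-fromℕ β)

prefixParity-suc : ∀ {m} (β : Vec Bool (suc m)) (j : Fin m) →
                   prefixParity β (suc j) ≡ prefixParity β (inject₁ j) xor lookup β (suc j)
prefixParity-suc (b ∷ c ∷ β) zero    = refl
prefixParity-suc (b ∷ β)     (suc j) =
  trans (cong (b xor_) (prefixParity-suc β j)) (sym (xor-assoc b (prefixParity β (inject₁ j)) _))

parityAssignment : ∀ {m} → Vec Bool (suc m) → Var (suc m) → Bool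
parityAssignment β (x i) = lookup β i
parityAssignment β u     = not (parity β)
parityAssignment β (t i) = prefixParity β i

parityAssignment-satisfies : ∀ {m} (β : Vec Bool (suc m)) → All (Satisfies (parityAssignment β)) (parityCNF m)
parityAssignment-satisfies {m} β@(_ ∷ _) =
  ++⁺ (iffCNF-satisfied α (t zero) (x zero) refl)
  (++⁺ (xorCNF-satisfied α u (t (fromℕ m)) (cong not (sym (prefixParity-fromℕ β))))
       (concat⁺ (map⁺ (All.universal xor3-step (allFinL m)))))
  where
  α : Var (suc m) → Bool
  α = parityAssignment β
  xor3-step : ∀ j → All (Satisfies α) (xor3CNF (t (inject₁ j)) (x (suc j)) (t (suc j)))
  xor3-step j = xor3CNF-satisfied α (t (inject₁ j)) (x (suc j)) (t (suc j)) (prefixParity-suc β j)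

-- Refutations

HasSign-from-identity : ∀ b q s → 0ℚ ≤ℚ s →
                        q *ℚ (1ℚ -ℚ (toℚ b +ℚ toℚ b)) +ℚ s +ℚ 1ℚ ≡ 0ℚ → HasSign b q
HasSign-from-identity true  q s 0≤s identity = subst (0ℚ <ℚ_) (sym q≡s+1) (0<s+1 0≤s)
  where
  open +-*-Solver
  q≡s+1 : q ≡ s +ℚ 1ℚ
  q≡s+1 = begin
    q                                                ≡⟨ rearrange q s ⟩
    s +ℚ 1ℚ -ℚ (q *ℚ (1ℚ -ℚ (1ℚ +ℚ 1ℚ)) +ℚ s +ℚ 1ℚ)  ≡⟨ cong (λ z → s +ℚ 1ℚ -ℚ z) identity ⟩
    s +ℚ 1ℚ -ℚ 0ℚ                                    ≡⟨ ℚ.+-identityʳ (s +ℚ 1ℚ) ⟩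
    s +ℚ 1ℚ                                          ∎
    where
    open ≡-Reasoning
    rearrange : ∀ q s → q ≡ s +ℚ 1ℚ -ℚ (q *ℚ (1ℚ -ℚ (1ℚ +ℚ 1ℚ)) +ℚ s +ℚ 1ℚ)
    rearrange = solve 2 (λ q s → q := (s :+ con 1ℚ) :- (q :* (con 1ℚ :- (con 1ℚ :+ con 1ℚ)) :+ s :+ con 1ℚ)) refl
HasSign-from-identity false q s 0≤s identity = subst (_<ℚ 0ℚ) (sym q≡-[s+1]) (ℚ.neg-antimono-< (0<s+1 0≤s))
  where
  open +-*-Solver
  q≡-[s+1] : q ≡ -ℚ (s +ℚ 1ℚ)
  q≡-[s+1] = begin
    q                                                ≡⟨ rearrange q s ⟩
    (q *ℚ (1ℚ -ℚ (0ℚ +ℚ 0ℚ)) +ℚ s +ℚ 1ℚ) -ℚ (s +ℚ 1ℚ)  ≡⟨ cong (_-ℚ (s +ℚ 1ℚ)) identity ⟩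
    0ℚ -ℚ (s +ℚ 1ℚ)                                  ≡⟨ ℚ.+-identityˡ _ ⟩
    -ℚ (s +ℚ 1ℚ)                                     ∎
    where
    open ≡-Reasoning
    rearrange : ∀ q s → q ≡ (q *ℚ (1ℚ -ℚ (0ℚ +ℚ 0ℚ)) +ℚ s +ℚ 1ℚ) -ℚ (s +ℚ 1ℚ)
    rearrange = solve 2 (λ q s → q := (q :* (con 1ℚ :- (con 0ℚ :+ con 0ℚ)) :+ s :+ con 1ℚ) :- (s :+ con 1ℚ)) refl

-- Only x-variables occur in qᵤ (qᵤ-scope); the other variables are sent to an arbitrary literal.
toLiteral : ∀ {m} → PVar (suc m) → Literal (suc m)
toLiteral (plain (x i)) = true , i
toLiteral (twin (x i))  = false , i
toLiteral _             = true , zero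

allᵇ-toLiteral : ∀ {m} (β : Vec Bool (suc m)) {d : Monomial (suc m)} → All LeftOfU d →
  allᵇ (literalValue β) (map toLiteral d) ≡ allᵇ (withTwins (parityAssignment β)) d
allᵇ-toLiteral β []                                  = refl
allᵇ-toLiteral β {plain (x i) ∷ d} (_ ∷ d⊆x)  = cong (lookup β i ∧_) (allᵇ-toLiteral β d⊆x)
allᵇ-toLiteral β {twin (x i) ∷ d}  (_ ∷ d⊆x)  = cong (not (lookup β i) ∧_) (allᵇ-toLiteral β d⊆x)
allᵇ-toLiteral β {plain u ∷ d}     (() ∷ _)
allᵇ-toLiteral β {plain (t _) ∷ d} (() ∷ _)
allᵇ-toLiteral β {twin u ∷ d}      (() ∷ _)
allᵇ-toLiteral β {twin (t _) ∷ d}  (() ∷ _)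

module _ {m : ℕ} (r : QSoSRefutation m) where
  open QSoSRefutation r

  eval-axiomPart : ∀ (ρ : PVar (suc m) → Bool) → All (λ p → eval ρ p ≡ 0ℚ) (encCNF (parityCNF m)) →
                   eval ρ (sumP (map (λ qp → proj₁ qp *P proj₂ qp) axiomPart)) ≡ 0ℚ
  eval-axiomPart ρ axioms≡0 =
    trans (eval-sumP ρ (map (λ qp → proj₁ qp *P proj₂ qp) axiomPart))
      (trans (∑-map (λ qp → proj₁ qp *P proj₂ qp) axiomPart (eval ρ)) (∑-zero axiomPart summand≡0))
    where
    summand≡0 : ∀ {qp} → qp ∈ axiomPart → eval ρ (proj₁ qp *P proj₂ qp) ≡ 0ℚ
    summand≡0 {q , p} qp∈ = begin
      eval ρ (q *P p)          ≡⟨ eval-*P ρ q p ⟩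
      eval ρ q *ℚ eval ρ p     ≡⟨ cong (eval ρ q *ℚ_) (All.lookup axioms≡0 (All.lookup axiomsFromEnc qp∈)) ⟩
      eval ρ q *ℚ 0ℚ           ≡⟨ ℚ.*-zeroʳ (eval ρ q) ⟩
      0ℚ                       ∎
      where open ≡-Reasoning

  eval-identity : ∀ (ρ : PVar (suc m) → Bool) → All (λ p → eval ρ p ≡ 0ℚ) (encCNF (parityCNF m)) →
    eval ρ qᵤ *ℚ (1ℚ -ℚ (toℚ (ρ (plain u)) +ℚ toℚ (ρ (plain u)))) +ℚ eval ρ (sos squares) +ℚ 1ℚ ≡ 0ℚ
  eval-identity ρ axioms≡0 = begin
    eval ρ qᵤ *ℚ (1ℚ -ℚ (toℚ ρu +ℚ toℚ ρu)) +ℚ eval ρ (sos squares) +ℚ 1ℚ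
      ≡⟨ cong (λ z → z +ℚ eval ρ (sos squares) +ℚ 1ℚ) factor≡ ⟨
    (eval ρ A +ℚ eval ρ (qᵤ *P K)) +ℚ eval ρ (sos squares) +ℚ eval ρ (const 1ℚ)
      ≡⟨ cong₂ _+ℚ_ (cong (_+ℚ eval ρ (sos squares)) (eval-+P ρ A (qᵤ *P K))) (eval-const ρ 1ℚ) ⟨
    eval ρ (A +P qᵤ *P K) +ℚ eval ρ (sos squares) +ℚ 1ℚ
      ≡⟨ cong (_+ℚ 1ℚ) (eval-+P ρ (A +P qᵤ *P K) (sos squares)) ⟨
    eval ρ (A +P qᵤ *P K +P sos squares) +ℚ 1ℚ
      ≡⟨ eval-+P ρ (A +P qᵤ *P K +P sos squares) (const 1ℚ) ⟨
    eval ρ (A +P qᵤ *P K +P sos squares +P const 1ℚ)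
      ≡⟨ eval-IsZeroPoly ρ (A +P qᵤ *P K +P sos squares +P const 1ℚ) identity ⟩
    0ℚ ∎
    where
    open ≡-Reasoning
    ρu : Bool
    ρu = ρ (plain u)
    A K : Poly (suc m)
    A = sumP (map (λ qp → proj₁ qp *P proj₂ qp) axiomPart)
    K = const 1ℚ -P (var (plain u) +P var (plain u))
    eval-K : eval ρ K ≡ 1ℚ -ℚ (toℚ ρu +ℚ toℚ ρu)
    eval-K = begin
      eval ρ K
        ≡⟨ eval-minusP ρ (const 1ℚ) (var (plain u) +P var (plain u)) ⟩
      eval ρ (const 1ℚ) -ℚ eval ρ (var (plain u) +P var (plain u))
        ≡⟨ cong₂ _-ℚ_ (eval-const ρ 1ℚ) (eval-+P ρ (var (plain u)) (var (plain u))) ⟩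
      1ℚ -ℚ (eval ρ (var (plain u)) +ℚ eval ρ (var (plain u)))
        ≡⟨ cong (λ z → 1ℚ -ℚ (z +ℚ z)) (eval-var ρ (plain u)) ⟩
      1ℚ -ℚ (toℚ ρu +ℚ toℚ ρu) ∎
    factor≡ : eval ρ A +ℚ eval ρ (qᵤ *P K) ≡ eval ρ qᵤ *ℚ (1ℚ -ℚ (toℚ ρu +ℚ toℚ ρu))
    factor≡ = begin
      eval ρ A +ℚ eval ρ (qᵤ *P K)    ≡⟨ cong₂ _+ℚ_ (eval-axiomPart ρ axioms≡0) (eval-*P ρ qᵤ K) ⟩
      0ℚ +ℚ eval ρ qᵤ *ℚ eval ρ K      ≡⟨ ℚ.+-identityˡ _ ⟩
      eval ρ qᵤ *ℚ eval ρ K            ≡⟨ cong (eval ρ qᵤ *ℚ_) eval-K ⟩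
      eval ρ qᵤ *ℚ (1ℚ -ℚ (toℚ ρu +ℚ toℚ ρu)) ∎

  qᵤ-literals : LitPoly (suc m)
  qᵤ-literals = map (λ d → coeff qᵤ d , map toLiteral d) (support qᵤ)

  eval-qᵤ-literals : ∀ (β : Vec Bool (suc m)) →
                     eval (literalValue β) qᵤ-literals ≡ eval (withTwins (parityAssignment β)) qᵤ
  eval-qᵤ-literals β = begin
    eval (literalValue β) qᵤ-literals
      ≡⟨ ∑-map (λ d → coeff qᵤ d , map toLiteral d) (support qᵤ) (termValue (literalValue β)) ⟩
    ∑ (support qᵤ) (λ d → coeff qᵤ d *ℚ toℚ (allᵇ (literalValue β) (map toLiteral d)))
      ≡⟨ ∑-cong (support qᵤ) (λ {d} d∈ → cong (λ b → coeff qᵤ d *ℚ toℚ b)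
                                       (allᵇ-toLiteral β (qᵤ-scope d (support-coeff≢0 qᵤ d∈)))) ⟩
    ∑ (support qᵤ) (λ d → coeff qᵤ d *ℚ monomialValue (withTwins (parityAssignment β)) d)
      ≡⟨ eval-support (withTwins (parityAssignment β)) qᵤ ⟨
    eval (withTwins (parityAssignment β)) qᵤ ∎
    where open ≡-Reasoning

  qᵤ-signRepresentsParity : SignRepresentsParity true (suc m) qᵤ-literals
  qᵤ-signRepresentsParity β =
    subst (HasSign (not (parity β))) (sym (eval-qᵤ-literals β))
      (HasSign-from-identity (not (parity β)) (eval ρ qᵤ) (eval ρ (sos squares))
        (eval-sos-nonNegative ρ squares)
        (eval-identity ρ (encCNF-vanishes α (parityAssignment-satisfies β))))
    where
    α : Var (suc m) → Bool
    α = parityAssignment β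
    ρ : PVar (suc m) → Bool
    ρ = withTwins α

  qSize-bound : 3 ^ suc m ≤ 2 ^ suc m * qSize r
  qSize-bound = subst (λ s → 3 ^ suc m ≤ 2 ^ suc m * s) (length-map _ (support qᵤ))
    (SignRepresentsParity⇒length true (suc m) qᵤ-literals qᵤ-signRepresentsParity)

^-distribʳ-* : ∀ a b N → (a * b) ^ N ≡ a ^ N * b ^ N
^-distribʳ-* a b zero    = refl
^-distribʳ-* a b (suc N) rewrite ^-distribʳ-* a b N = interchange a b (a ^ N) (b ^ N)
  where
  interchange : ∀ a b x y → a * b * (x * y) ≡ a * x * (b * y)
  interchange = solve-∀

3^N≤2^N*s⇒2^N≤s² : ∀ N s → 3 ^ N ≤ 2 ^ N * s → 2 ^ N ≤ s ^ 2
3^N≤2^N*s⇒2^N≤s² N s 3^N≤2^N*s = *-cancelˡ-≤ (4 ^ N) {{m^n≢0 4 N}} (begin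
  4 ^ N * 2 ^ N                ≡⟨ ^-distribʳ-* 4 2 N ⟨
  8 ^ N                        ≤⟨ ^-monoˡ-≤ N (n≤1+n 8) ⟩
  9 ^ N                        ≡⟨ ^-distribʳ-* 3 3 N ⟩
  3 ^ N * 3 ^ N                ≤⟨ *-mono-≤ 3^N≤2^N*s 3^N≤2^N*s ⟩
  2 ^ N * s * (2 ^ N * s)      ≡⟨ regroup (2 ^ N) s ⟩
  2 ^ N * 2 ^ N * s ^ 2        ≡⟨ cong (_* s ^ 2) (^-distribʳ-* 2 2 N) ⟨
  4 ^ N * s ^ 2                ∎)
  where
  open ≤-Reasoning
  regroup : ∀ y s → y * s * (y * s) ≡ y * y * (s * (s * 1))
  regroup = solve-∀

corollary4p4 : ∃₂ λ (k N : ℕ) → 1 ≤ k × ((m : ℕ) → N ≤ m →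
    (r : QSoSRefutation m) → 2 ^ suc m ≤ qSize r ^ k)
corollary4p4 = 2 , 0 , s≤s z≤n , λ m _ r → 3^N≤2^N*s⇒2^N≤s² (suc m) (qSize r) (qSize-bound r)
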